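{- Let $k\geq 2$. Then $\operatorname{ZIR}(N_k)=2k=\frac{1}{2}|V(N_k)|$.
   Context: A diamond is $K_4$ with one edge deleted. For $i=1,\dots,k$ let $D_i$ be a diamond on vertex set $\{a_i,b_i,c_i,d_i\}$ with the edge $a_ic_i$ missing. The $k$th necklace $N_k$ is the graph consisting of $D_1,\dots,D_k$ together with the edges $c_ia_{i+1}$ for $1\le i\le k-1$ and $c_ka_1$. A fort is a nonempty $F\subseteq V(G)$ such that every $v\notin F$ has $|F\cap N(v)|\neq 1$. For $S\subseteq V(G)$, $x\in S$, a private fort of $x$ relative to $S$ is a fort $F$ with $S\cap F=\{x\}$; $S$ is a ZIr-set if every element has a private fort. $\operatorname{ZIR}(G)$ is the maximum cardinality of an inclusion-maximal ZIr-set of $G$. -}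

module Defs where

open import Data.Nat using (ℕ; zero; suc; _≡ᵇ_; _*_; _≤_)
open import Data.Fin using (Fin; toℕ; remQuot)
open import Data.Fin.Subset using (Subset; _∈_; _∉_; _⊂_; _∩_; ∣_∣; Nonempty)
open import Data.Bool using (Bool; true; false; _∧_; _∨_; not; if_then_else_)
open import Data.Vec using (tabulate)
open import Data.Product using (_×_; _,_; ∃)
open import Relation.Binary.PropositionalEquality using (_≡_)
open import Relation.Nullary using (¬_)

Graph : ℕ → Set
Graph n = Fin n → Fin n → Bool

N : ∀ {n} → Graph n → Fin n → Subset n
N G v = tabulate (G v)

IsFort : ∀ {n} → Graph n → Subset n → Set
IsFort G F = Nonempty F × (∀ v → v ∉ F → ¬ (∣ F ∩ N G v ∣ ≡ 1))

IsPrivateFort : ∀ {n} → Graph n → Subset n → Fin n → Subset n → Set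
IsPrivateFort G S x F =
  IsFort G F × (x ∈ S) × (x ∈ F) × (∀ y → y ∈ S → y ∈ F → y ≡ x)

IsZIrSet : ∀ {n} → Graph n → Subset n → Set
IsZIrSet G S = ∀ x → x ∈ S → ∃ λ F → IsPrivateFort G S x F

IsMaximalZIrSet : ∀ {n} → Graph n → Subset n → Set
IsMaximalZIrSet G S = IsZIrSet G S × (∀ T → S ⊂ T → ¬ IsZIrSet G T)

IsZIR : ∀ {n} → Graph n → ℕ → Set
IsZIR G m =
  (∃ λ S → IsMaximalZIrSet G S × ∣ S ∣ ≡ m) ×
  (∀ S → IsMaximalZIrSet G S → ∣ S ∣ ≤ m)

-- The necklace N_k.  Vertex set Fin (k * 4); vertex v corresponds to
-- (i , r) = remQuot 4 v with i : Fin k the diamond index and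
-- r : Fin 4 the role: 0 = a_i, 1 = b_i, 2 = c_i, 3 = d_i.

private
  eqF : ∀ {m} → Fin m → Fin m → Bool
  eqF x y = toℕ x ≡ᵇ toℕ y

  isNext : ∀ {k} → Fin k → Fin k → Bool
  isNext {k} i j = (suc (toℕ i) ≡ᵇ toℕ j) ∨ ((toℕ j ≡ᵇ 0) ∧ (suc (toℕ i) ≡ᵇ k))

  isAC : ∀ {m} → Fin m → Fin m → Bool
  isAC r s = ((toℕ r ≡ᵇ 0) ∧ (toℕ s ≡ᵇ 2)) ∨ ((toℕ r ≡ᵇ 2) ∧ (toℕ s ≡ᵇ 0))

  nadj : ∀ {k} → Fin k × Fin 4 → Fin k × Fin 4 → Bool
  nadj (i , r) (j , s) =
    -- inside diamond D_i : all pairs except a_i c_i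
    (eqF i j ∧ not (eqF r s) ∧ not (isAC r s))
    -- edges c_i a_{i+1} (indices cyclic, c_k a_1 included)
    ∨ ((toℕ r ≡ᵇ 2) ∧ (toℕ s ≡ᵇ 0) ∧ isNext i j)
    ∨ ((toℕ r ≡ᵇ 0) ∧ (toℕ s ≡ᵇ 2) ∧ isNext j i)

necklaceAdj : (k : ℕ) → Fin (k * 4) → Fin (k * 4) → Bool
necklaceAdj k u v = nadj (remQuot {k} 4 u) (remQuot {k} 4 v)

necklace : (k : ℕ) → Graph (k * 4)
necklace k = necklaceAdj k

-- The vertices a_i, b_i of all diamonds form a ZIr-set of size 2k: the private fort of a_i is
-- {a_i} ∪ {c_j | all j} ∪ {d_j | j ≠ i}, and that of b_i is {b_i, d_i}.
-- Conversely, the fort condition at a vertex involves only its own diamond and the edge joining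
-- that diamond to the previous or the next one. So if S is a ZIr-set, every element of S in two
-- consecutive diamonds D_i ∪ D_{i+1} has a local private fort: a subset of
-- D_i ∪ D_{i+1} ∪ {c_{i-1}, a_{i+2}} satisfying the fort condition at the eight diamond vertices.
-- Checking all 2⁸ traces of S against all 2¹⁰ such subsets shows that S has at most 4 elements in
-- D_i ∪ D_{i+1}. Summing over the k edges of the cycle of diamonds counts each diamond twice, so
-- |S| ≤ 2k; in particular {a_i, b_i} is inclusion-maximal.

module Submission where

open import Defs
import Data.Nat as ℕ
open import Data.Nat using (ℕ; zero; suc; _+_; _*_; _≤_; _<_; _≡ᵇ_; _≤ᵇ_; z≤n; s≤s; s≤s⁻¹)
open import Data.Nat.Properties using (≡ᵇ⇒≡; ≡⇒≡ᵇ; ≤ᵇ⇒≤; suc-injective; <⇒≱; <⇒≢; 0≢1+n; 1+n≢0; <-irrefl; n<1+n; +-mono-≤; +-comm; *-cancelˡ-≤; *-suc; module ≤-Reasoning; +-0-commutativeMonoid)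
open import Data.Fin using (Fin; zero; suc; toℕ; combine; inject₁; fromℕ; lower₁; punchIn; punchOut; _≟_)
open import Data.Fin.Properties using (toℕ-injective; toℕ<n; toℕ-inject₁; toℕ-fromℕ; inject₁-lower₁; remQuot-combine; combine-injective; combine-surjective; punchIn-injective; punchInᵢ≢i; punchIn-punchOut)
open import Data.Fin.Subset using (Subset; _∈_; _∉_; _∩_; _-_; _⊂_; ⁅_⁆; ∣_∣; Nonempty)
open import Data.Fin.Subset.Properties using (⊆-antisym; ∣⁅x⁆∣≡1; x∈⁅y⁆⇒x≡y; x∈⁅x⁆; p⊆q⇒∣p∣≤∣q∣; x∈p⇒∣p-x∣<∣p∣; x∈p∧x≢y⇒x∈p-y; nonempty?; Empty-unique; ∣⊥∣≡0; x∈p∩q⁺; x∈p∩q⁻; p⊂q⇒∣p∣<∣q∣)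
open import Data.Bool using (Bool; true; false; _∧_; _∨_; not; T)
open import Data.Bool.Properties using (T-∧; T-∨; T-≡)
open import Data.Unit using (tt)
open import Data.Vec using ([]; _∷_; lookup; tabulate; _++_; concat)
open import Data.Vec.Functional using (head; tail; init; last)
open import Data.Vec.Properties using (lookup∘tabulate; tabulate-cong; tabulate∘lookup; lookup-concat; []=⇒lookup; lookup⇒[]=)
open import Data.Product using (_×_; _,_; ∃; proj₁; proj₂)
open import Data.Product.Properties using (≡-dec)
open import Data.Sum using (_⊎_; inj₁; inj₂)
open import Data.Empty using (⊥-elim; ⊥-elim-irr)
open import Function using (_∘_; _⇔_; mk⇔; Equivalence; Injective)
open import Relation.Nullary using (¬_; yes; no)
open import Relation.Nullary.Decidable using (⌊_⌋; fromWitness; toWitness)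
open import Relation.Binary.Definitions using (DecidableEquality)
open import Relation.Binary.PropositionalEquality using (_≡_; _≢_; refl; sym; trans; cong; cong₂; subst; subst₂; module ≡-Reasoning)

open Equivalence using (to; from)
open import Function.Properties.Equivalence using () renaming (sym to ⇔-sym)
open import Algebra.Properties.CommutativeMonoid.Sum +-0-commutativeMonoid using (sum; sum-init-last; ∑-distrib-+)
open import Data.Nat.Solver using (module +-*-Solver)
open +-*-Solver using (solve; _:+_; _:*_; con; _:=_)

∀ᵇ : (Bool → Bool) → Bool
∀ᵇ P = P true ∧ P false

∧-≡-true : ∀ {a b} → a ∧ b ≡ true → a ≡ true × b ≡ true
∧-≡-true {true} {true} refl = refl , refl

∀ᵇ-sound : ∀ P → ∀ᵇ P ≡ true → ∀ x → P x ≡ true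
∀ᵇ-sound P h true  = proj₁ (∧-≡-true {P true} h)
∀ᵇ-sound P h false = proj₂ (∧-≡-true {P true} h)

∀ᶠ : ∀ {n} → (Fin n → Bool) → Bool
∀ᶠ {zero}  P = true
∀ᶠ {suc n} P = P zero ∧ ∀ᶠ (P ∘ suc)

T-∀ᶠ : ∀ {n} (P : Fin n → Bool) → T (∀ᶠ P) ⇔ (∀ i → T (P i))
T-∀ᶠ {zero}  P = mk⇔ (λ _ ()) (λ _ → tt)
T-∀ᶠ {suc n} P = mk⇔
  (λ h → λ { zero → proj₁ (to (T-∧ {P zero}) h) ; (suc i) → to (T-∀ᶠ (P ∘ suc)) (proj₂ (to (T-∧ {P zero}) h)) i })
  (λ h → from (T-∧ {P zero}) (h zero , from (T-∀ᶠ (P ∘ suc)) (h ∘ suc)))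

∀ˢ : ∀ {n} → (Subset n → Bool) → Bool
∀ˢ {zero}  P = P []
∀ˢ {suc n} P = ∀ᵇ λ x → ∀ˢ (P ∘ (x ∷_))

-- Stated with ≡ true rather than T: for the closed instance used below, T (∀ˢ P) would be
-- normalised again whenever types are compared, which makes type checking far slower.
∀ˢ-sound : ∀ {n} (P : Subset n → Bool) → ∀ˢ P ≡ true → ∀ p → P p ≡ true
∀ˢ-sound P h []      = h
∀ˢ-sound P h (x ∷ p) = ∀ˢ-sound (P ∘ (x ∷_)) (∀ᵇ-sound (λ x → ∀ˢ (P ∘ (x ∷_))) h x) p

T-not : ∀ {b} → T (not b) → ¬ T b
T-not {false} _ ()

T-not-∨ : ∀ {b c} → (T b → T c) → T (not b ∨ c)
T-not-∨ {false} _ = tt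
T-not-∨ {true}  h = h tt

∈⇔T : ∀ {n} {x : Fin n} {p : Subset n} → x ∈ p ⇔ T (lookup p x)
∈⇔T {x = x} {p} = mk⇔ (from T-≡ ∘ []=⇒lookup) (lookup⇒[]= x p ∘ to T-≡)

x∈p⇒0<∣p∣ : ∀ {n} {x : Fin n} {p : Subset n} → x ∈ p → 0 < ∣ p ∣
x∈p⇒0<∣p∣ {x = x} x∈p =
  subst (_≤ _) (∣⁅x⁆∣≡1 x) (p⊆q⇒∣p∣≤∣q∣ λ y∈⁅x⁆ → subst (_∈ _) (sym (x∈⁅y⁆⇒x≡y x y∈⁅x⁆)) x∈p)

IsSingleton : ∀ {n} → Subset n → Set
IsSingleton p = ∃ λ x → x ∈ p × ∀ {y} → y ∈ p → y ≡ x

∣p∣≡1⇔IsSingleton : ∀ {n : ℕ} (p : Subset n) → ∣ p ∣ ≡ 1 ⇔ IsSingleton p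
∣p∣≡1⇔IsSingleton {n} p = mk⇔ unique singleton
  where
  singleton : IsSingleton p → ∣ p ∣ ≡ 1
  singleton (x , x∈p , only-x) = trans (cong ∣_∣ p≡⁅x⁆) (∣⁅x⁆∣≡1 x)
    where
    p≡⁅x⁆ = ⊆-antisym (λ y∈p → subst (_∈ ⁅ x ⁆) (sym (only-x y∈p)) (x∈⁅x⁆ x))
                       (λ y∈⁅x⁆ → subst (_∈ p) (sym (x∈⁅y⁆⇒x≡y x y∈⁅x⁆)) x∈p)
  unique : ∣ p ∣ ≡ 1 → IsSingleton p
  unique ∣p∣≡1 with nonempty? p
  ... | no ¬nonempty = ⊥-elim (0≢1+n (trans (sym (trans (cong ∣_∣ (Empty-unique ¬nonempty)) (∣⊥∣≡0 n))) ∣p∣≡1))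
  ... | yes (x , x∈p) = x , x∈p , only-x
    where
    only-x : ∀ {y} → y ∈ p → y ≡ x
    only-x {y} y∈p with y ≟ x
    ... | yes y≡x = y≡x
    ... | no  y≢x = ⊥-elim (<⇒≱ (x∈p⇒0<∣p∣ (x∈p∧x≢y⇒x∈p-y y∈p y≢x))
                               (s≤s⁻¹ (subst (∣ p - x ∣ <_) ∣p∣≡1 (x∈p⇒∣p-x∣<∣p∣ x∈p))))

∣p++q∣≡∣p∣+∣q∣ : ∀ {m n} (p : Subset m) (q : Subset n) → ∣ p ++ q ∣ ≡ ∣ p ∣ + ∣ q ∣
∣p++q∣≡∣p∣+∣q∣ []          q = refl
∣p++q∣≡∣p∣+∣q∣ (true  ∷ p) q = cong suc (∣p++q∣≡∣p∣+∣q∣ p q)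
∣p++q∣≡∣p∣+∣q∣ (false ∷ p) q = ∣p++q∣≡∣p∣+∣q∣ p q

module _ {n : ℕ} (G : Graph n) where

  IsNeighbourList : ∀ {d} → Fin n → (Fin d → Fin n) → Set
  IsNeighbourList v u = Injective _≡_ _≡_ u × (∀ w → T (G v w) ⇔ ∃ λ m → u m ≡ w)

  ∣F∩N∣≡1⇔∣F∘u∣≡1 : ∀ {d v} {u : Fin d → Fin n} → IsNeighbourList v u →
             ∀ F → ∣ F ∩ N G v ∣ ≡ 1 ⇔ ∣ tabulate (lookup F ∘ u) ∣ ≡ 1
  ∣F∩N∣≡1⇔∣F∘u∣≡1 {v = v} {u} (u-injective , neighbour⇔) F =
    mk⇔ (λ h → from (∣p∣≡1⇔IsSingleton F∘u) (singleton-F∘u (to (∣p∣≡1⇔IsSingleton (F ∩ N G v)) h)))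
        (λ h → from (∣p∣≡1⇔IsSingleton (F ∩ N G v)) (singleton-F∩N (to (∣p∣≡1⇔IsSingleton F∘u) h)))
    where
    F∘u = tabulate (lookup F ∘ u)

    ∈F∩N⇔ : ∀ {w} → w ∈ F ∩ N G v ⇔ (w ∈ F × T (G v w))
    ∈F∩N⇔ {w} = mk⇔
      (λ w∈ → let w∈F , w∈N = x∈p∩q⁻ F (N G v) w∈ in w∈F , subst T (lookup∘tabulate (G v) w) (to ∈⇔T w∈N))
      (λ (w∈F , adj) → x∈p∩q⁺ (w∈F , from ∈⇔T (subst T (sym (lookup∘tabulate (G v) w)) adj)))

    ∈F∘u⇔ : ∀ {m} → m ∈ F∘u ⇔ u m ∈ F
    ∈F∘u⇔ {m} = mk⇔
      (λ m∈ → from ∈⇔T (subst T (lookup∘tabulate (lookup F ∘ u) m) (to ∈⇔T m∈)))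
      (λ um∈ → from ∈⇔T (subst T (sym (lookup∘tabulate (lookup F ∘ u) m)) (to ∈⇔T um∈)))

    singleton-F∘u : IsSingleton (F ∩ N G v) → IsSingleton F∘u
    singleton-F∘u (x , x∈ , only-x) with to (neighbour⇔ x) (proj₂ (to ∈F∩N⇔ x∈))
    ... | m , refl = m , from ∈F∘u⇔ (proj₁ (to ∈F∩N⇔ x∈)) , λ {m′} m′∈ →
      u-injective (only-x (from ∈F∩N⇔ (to ∈F∘u⇔ m′∈ , from (neighbour⇔ (u m′)) (m′ , refl))))

    singleton-F∩N : IsSingleton F∘u → IsSingleton (F ∩ N G v)
    singleton-F∩N (m , m∈ , only-m) =
      u m , from ∈F∩N⇔ (to ∈F∘u⇔ m∈ , from (neighbour⇔ (u m)) (m , refl)) , λ {y} y∈ →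
        let y∈F , adj = to ∈F∩N⇔ y∈ in
        case-neighbour y∈F (to (neighbour⇔ y) adj)
      where
      case-neighbour : ∀ {y} → y ∈ F → (∃ λ m′ → u m′ ≡ y) → y ≡ u m
      case-neighbour y∈F (m′ , refl) = cong u (only-m (from ∈F∘u⇔ y∈F))

largest-ZIrSet⇒IsZIR : ∀ {n} (G : Graph n) {m S} → IsZIrSet G S → ∣ S ∣ ≡ m →
                       (∀ {S} → IsZIrSet G S → ∣ S ∣ ≤ m) → IsZIR G m
largest-ZIrSet⇒IsZIR G {m} {S} zir ∣S∣≡m bound = (S , (zir , maximal) , ∣S∣≡m) , λ _ (zir′ , _) → bound zir′
  where
  maximal : ∀ S′ → S ⊂ S′ → ¬ IsZIrSet G S′
  maximal S′ S⊂S′ zir′ = <⇒≱ (subst (_< ∣ S′ ∣) ∣S∣≡m (p⊂q⇒∣p∣<∣q∣ S⊂S′)) (bound zir′)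

-- The cycle of diamonds

-- isNext, sameIndex, diamondEdge and adjacency below repeat private definitions of Defs verbatim,
-- so that necklace unfolds to them.
isNext : ∀ {k} → Fin k → Fin k → Bool
isNext {k} i j = (suc (toℕ i) ≡ᵇ toℕ j) ∨ ((toℕ j ≡ᵇ 0) ∧ (suc (toℕ i) ≡ᵇ k))

-- A record rather than T (isNext i j), so that i and j can be inferred from a proof.
infix 4 _↝_
record _↝_ {k} (i j : Fin k) : Set where
  constructor mk↝
  field T-isNext : T (isNext i j)

↝-cases : ∀ {k} {i j : Fin k} → i ↝ j → suc (toℕ i) ≡ toℕ j ⊎ (toℕ j ≡ 0 × suc (toℕ i) ≡ k)
↝-cases {i = i} {j} (mk↝ h) with to (T-∨ {suc (toℕ i) ≡ᵇ toℕ j}) h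
... | inj₁ i+1≡j = inj₁ (≡ᵇ⇒≡ _ _ i+1≡j)
... | inj₂ wraps = let j≡0 , i+1≡k = to (T-∧ {toℕ j ≡ᵇ 0}) wraps in
                   inj₂ (≡ᵇ⇒≡ _ _ j≡0 , ≡ᵇ⇒≡ _ _ i+1≡k)

module _ {k : ℕ} {i j : Fin k} where

  ↝-functional : ∀ {j′} → i ↝ j → i ↝ j′ → j ≡ j′
  ↝-functional {j′} h h′ with ↝-cases h | ↝-cases h′
  ... | inj₁ a       | inj₁ b       = toℕ-injective (trans (sym a) b)
  ... | inj₁ a       | inj₂ (_ , b) = ⊥-elim (<⇒≢ (toℕ<n j) (trans (sym a) b))
  ... | inj₂ (_ , a) | inj₁ b       = ⊥-elim (<⇒≢ (toℕ<n j′) (trans (sym b) a))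
  ... | inj₂ (a , _) | inj₂ (b , _) = toℕ-injective (trans a (sym b))

  ↝-injective : ∀ {i′} → i ↝ j → i′ ↝ j → i ≡ i′
  ↝-injective h h′ with ↝-cases h | ↝-cases h′
  ... | inj₁ a       | inj₁ b       = toℕ-injective (suc-injective (trans a (sym b)))
  ... | inj₁ a       | inj₂ (b , _) = ⊥-elim (1+n≢0 (trans a b))
  ... | inj₂ (a , _) | inj₁ b       = ⊥-elim (1+n≢0 (trans b a))
  ... | inj₂ (_ , a) | inj₂ (_ , b) = toℕ-injective (suc-injective (trans a (sym b)))

↝-irreflexive : ∀ {k} → 2 ≤ k → {i : Fin k} → ¬ i ↝ i
↝-irreflexive 2≤k {i} h with ↝-cases h
... | inj₁ i+1≡i         = <-irrefl (sym i+1≡i) (n<1+n (toℕ i))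
... | inj₂ (i≡0 , i+1≡k) with subst (2 ≤_) (trans (sym i+1≡k) (cong suc i≡0)) 2≤k
...   | s≤s ()

inject₁↝suc : ∀ {n} (i : Fin n) → inject₁ i ↝ suc i
inject₁↝suc i = mk↝ (from T-∨ (inj₁ (≡⇒≡ᵇ _ _ (cong suc (toℕ-inject₁ i)))))

fromℕ↝zero : ∀ n → fromℕ n ↝ zero
fromℕ↝zero n = mk↝ (≡⇒≡ᵇ _ _ (toℕ-fromℕ n))

predecessor : ∀ {n} (j : Fin (suc n)) → ∃ (_↝ j)
predecessor {n} zero    = fromℕ n , fromℕ↝zero n
predecessor     (suc j) = inject₁ j , inject₁↝suc j

successor : ∀ {n} (i : Fin (suc n)) → ∃ (i ↝_)
successor {n} i with n ℕ.≟ toℕ i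
... | yes n≡i = zero , mk↝ (≡⇒≡ᵇ _ _ (sym n≡i))
... | no  n≢i = suc i′ , subst (_↝ suc i′) (inject₁-lower₁ i n≢i) (inject₁↝suc i′)
  where i′ = lower₁ i n≢i

sum-≤ : ∀ {n m} (f : Fin n → ℕ) → (∀ i → f i ≤ m) → sum f ≤ n * m
sum-≤ {zero}  f f≤m = z≤n
sum-≤ {suc n} f f≤m = +-mono-≤ (f≤m zero) (sum-≤ (f ∘ suc) (f≤m ∘ suc))

-- Every diamond is counted once as the left and once as the right end of an edge of the cycle.
2*sum≡sum-edges : ∀ {n} (f : Fin (suc n) → ℕ) →
                  2 * sum f ≡ sum (λ i → f (inject₁ i) + f (suc i)) + (f (fromℕ n) + f zero)
2*sum≡sum-edges f = begin
  2 * sum f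
    ≡⟨ cong (_+ (sum f + 0)) (sum-init-last f) ⟩
  (sum (init f) + last f) + ((head f + sum (tail f)) + 0)
    ≡⟨ solve 4 (λ a l h b → (a :+ l) :+ ((h :+ b) :+ con 0) := (a :+ b) :+ (l :+ h)) refl
             (sum (init f)) (last f) (head f) (sum (tail f)) ⟩
  (sum (init f) + sum (tail f)) + (last f + head f)
    ≡⟨ cong (_+ (last f + head f)) (∑-distrib-+ (init f) (tail f)) ⟨
  sum (λ i → f (inject₁ i) + f (suc i)) + (f (fromℕ _) + f zero) ∎
  where open ≡-Reasoning

sum-cycle-≤ : ∀ {n m} (f : Fin (suc n) → ℕ) → (∀ {i j} → i ↝ j → f i + f j ≤ m) → 2 * sum f ≤ suc n * m
sum-cycle-≤ {n} {m} f edge≤m = begin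
  2 * sum f                                                         ≡⟨ 2*sum≡sum-edges f ⟩
  sum (λ i → f (inject₁ i) + f (suc i)) + (f (fromℕ n) + f zero)    ≤⟨ +-mono-≤ (sum-≤ _ λ i → edge≤m (inject₁↝suc i))
                                                                                  (edge≤m (fromℕ↝zero n)) ⟩
  n * m + m                                                         ≡⟨ +-comm (n * m) m ⟩
  suc n * m                                                         ∎
  where open ≤-Reasoning

-- Adjacency in the necklace

Role : Set
Role = Fin 4

pattern A = zero
pattern B = suc zero
pattern C = suc (suc zero)
pattern D = suc (suc (suc zero))

vertex : ∀ {k} → Fin k → Role → Fin (k * 4)
vertex = combine

sameIndex : ∀ {m} → Fin m → Fin m → Bool
sameIndex x y = toℕ x ≡ᵇ toℕ y

sameIndex⇔ : ∀ {m} {x y : Fin m} → T (sameIndex x y) ⇔ x ≡ y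
sameIndex⇔ = mk⇔ (toℕ-injective ∘ ≡ᵇ⇒≡ _ _) (λ x≡y → ≡⇒≡ᵇ _ _ (cong toℕ x≡y))

diamondEdge : Role → Role → Bool
diamondEdge r s =
  not (sameIndex r s) ∧ not (((toℕ r ≡ᵇ 0) ∧ (toℕ s ≡ᵇ 2)) ∨ ((toℕ r ≡ᵇ 2) ∧ (toℕ s ≡ᵇ 0)))

diamondEdge-irreflexive : ∀ r → ¬ T (diamondEdge r r)
diamondEdge-irreflexive A ()
diamondEdge-irreflexive B ()
diamondEdge-irreflexive C ()
diamondEdge-irreflexive D ()

data Edge {k} : Fin k → Role → Fin k → Role → Set where
  inside  : ∀ {i r s} → T (diamondEdge r s) → Edge i r i s
  forward : ∀ {i j} → i ↝ j → Edge i C j A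
  back    : ∀ {i j} → j ↝ i → Edge i A j C

-- How the vertex of role r in D_i reaches its neighbour of role s: inside D_i, or along c_i a_{i+1} or a_i c_{i-1}.
data Link : Role → Role → Set where
  inside  : ∀ {r s} → T (diamondEdge r s) → Link r s
  forward : Link C A
  back    : Link A C

link : ∀ r s → .(s ≢ r) → Link r s
link A A s≢r = ⊥-elim-irr (s≢r refl)
link A B _   = inside tt
link A C _   = back
link A D _   = inside tt
link B A _   = inside tt
link B B s≢r = ⊥-elim-irr (s≢r refl)
link B C _   = inside tt
link B D _   = inside tt
link C A _   = forward
link C B _   = inside tt
link C C s≢r = ⊥-elim-irr (s≢r refl)
link C D _   = inside tt
link D A _   = inside tt
link D B _   = inside tt
link D C _   = inside tt
link D D s≢r = ⊥-elim-irr (s≢r refl)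

pick : ∀ {X : Set} {r s} → Link r s → (before here after : X) → X
pick (inside _) before here after = here
pick forward    before here after = after
pick back       before here after = before

module Adjacency {k : ℕ} where

  G : Graph (k * 4)
  G = necklace k

  adjacent⇔Edge : ∀ {i j r s} → T (G (vertex i r) (vertex j s)) ⇔ Edge i r j s
  adjacent⇔Edge {i} {j} {r} {s} = mk⇔ edge adjacent
    where
    adjacency : Fin k × Role → Fin k × Role → Bool
    adjacency (i , r) (j , s) =
      (sameIndex i j ∧ diamondEdge r s) ∨
      ((toℕ r ≡ᵇ 2) ∧ (toℕ s ≡ᵇ 0) ∧ isNext i j) ∨ ((toℕ r ≡ᵇ 0) ∧ (toℕ s ≡ᵇ 2) ∧ isNext j i)

    G≡adjacency : G (vertex i r) (vertex j s) ≡ adjacency (i , r) (j , s)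
    G≡adjacency = cong₂ adjacency (remQuot-combine i r) (remQuot-combine j s)

    edge : T (G (vertex i r) (vertex j s)) → Edge i r j s
    edge h with to (T-∨ {sameIndex i j ∧ diamondEdge r s}) (subst T G≡adjacency h)
    ... | inj₁ inner = let i≡j , e = to (T-∧ {sameIndex i j}) inner in
                       subst (λ j → Edge i r j s) (to sameIndex⇔ i≡j) (inside e)
    ... | inj₂ outer with to (T-∨ {(toℕ r ≡ᵇ 2) ∧ (toℕ s ≡ᵇ 0) ∧ isNext i j}) outer
    ...   | inj₁ fwd = let r≡C , rest = to (T-∧ {toℕ r ≡ᵇ 2}) fwd ; s≡A , i↝j = to (T-∧ {toℕ s ≡ᵇ 0}) rest
                       in subst₂ (λ r s → Edge i r j s) (sym (to sameIndex⇔ r≡C)) (sym (to sameIndex⇔ s≡A))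
                                 (forward (mk↝ i↝j))
    ...   | inj₂ bwd = let r≡A , rest = to (T-∧ {toℕ r ≡ᵇ 0}) bwd ; s≡C , j↝i = to (T-∧ {toℕ s ≡ᵇ 2}) rest
                       in subst₂ (λ r s → Edge i r j s) (sym (to sameIndex⇔ r≡A)) (sym (to sameIndex⇔ s≡C))
                                 (back (mk↝ j↝i))

    adjacent : Edge i r j s → T (G (vertex i r) (vertex j s))
    adjacent e = subst T (sym G≡adjacency) (disjunct e)
      where
      disjunct : ∀ {i j r s} → Edge i r j s → T (adjacency (i , r) (j , s))
      disjunct {i} (inside {r = r} {s} e) =
        from (T-∨ {sameIndex i i ∧ diamondEdge r s}) (inj₁ (from (T-∧ {sameIndex i i}) (from (sameIndex⇔ {x = i}) refl , e)))
      disjunct {i} {j} (forward (mk↝ i↝j)) =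
        from (T-∨ {sameIndex i j ∧ false}) (inj₂ (from T-∨ (inj₁ i↝j)))
      disjunct {i} {j} (back (mk↝ j↝i)) =
        from (T-∨ {sameIndex i j ∧ false}) (inj₂ (from (T-∨ {false}) (inj₂ j↝i)))

  Edge-roles-differ : ∀ {i j : Fin k} {r s} → Edge i r j s → s ≢ r
  Edge-roles-differ (inside {r = r} e) refl = diamondEdge-irreflexive r e
  Edge-roles-differ (forward _) ()
  Edge-roles-differ (back _)    ()

  module _ {p i q : Fin k} (p↝i : p ↝ i) (i↝q : i ↝ q) where

    Edge-pick : ∀ {r s} (l : Link r s) → Edge i r (pick l p i q) s
    Edge-pick (inside e) = inside e
    Edge-pick forward    = forward i↝q
    Edge-pick back       = back p↝i

    pick-unique : ∀ {r s j} (l : Link r s) → Edge i r j s → pick l p i q ≡ j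
    pick-unique (inside _) (inside _)    = refl
    pick-unique (inside e) (forward _)   = ⊥-elim e
    pick-unique (inside e) (back _)      = ⊥-elim e
    pick-unique forward    (inside e)    = ⊥-elim e
    pick-unique forward    (forward i↝j) = ↝-functional i↝q i↝j
    pick-unique back       (inside e)    = ⊥-elim e
    pick-unique back       (back j↝i)    = ↝-injective p↝i j↝i

    -- Every vertex has exactly one neighbour of each other role, so punchIn r enumerates its neighbourhood.
    neighbour : Role → Fin 3 → Fin (k * 4)
    neighbour r m = vertex (pick (link r (punchIn r m) (punchInᵢ≢i r m)) p i q) (punchIn r m)

    neighbour-list : ∀ r → IsNeighbourList G (vertex i r) (neighbour r)
    neighbour-list r = injective , neighbours
      where
      injective : Injective _≡_ _≡_ (neighbour r)
      injective {m} {m′} eq = punchIn-injective r m m′ (proj₂ (combine-injective {k} {4} _ _ _ _ eq))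

      neighbour-complete : ∀ {j s} → Edge i r j s → ∃ λ m → neighbour r m ≡ vertex j s
      neighbour-complete {j} {s} e = m , role-matches (punchIn-punchOut r≢s) e
        where
        r≢s : r ≢ s
        r≢s = Edge-roles-differ e ∘ sym
        m = punchOut r≢s
        role-matches : ∀ {t} → punchIn r m ≡ t → Edge i r j t → neighbour r m ≡ vertex j t
        role-matches refl e = cong (λ j → vertex j (punchIn r m)) (pick-unique (link r (punchIn r m) _) e)

      neighbours : ∀ w → T (G (vertex i r) w) ⇔ ∃ λ m → neighbour r m ≡ w
      neighbours w with combine-surjective {k} {4} w
      ... | j , s , refl = mk⇔ (neighbour-complete ∘ to adjacent⇔Edge)
        λ (m , eq) → subst (T ∘ G (vertex i r)) eq (from adjacent⇔Edge (Edge-pick (link r (punchIn r m) _)))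

-- Forts, diamond by diamond

fortConditionᵇ : ∀ {d} → Bool → Subset d → Bool
fortConditionᵇ x nb = x ∨ not (∣ nb ∣ ≡ᵇ 1)

T-fortConditionᵇ : ∀ {d x} {nb : Subset d} → T (fortConditionᵇ x nb) ⇔ (¬ T x → ∣ nb ∣ ≢ 1)
T-fortConditionᵇ {x = true}       = mk⇔ (λ _ ¬x → ⊥-elim (¬x tt)) (λ _ → tt)
T-fortConditionᵇ {x = false} {nb} with ∣ nb ∣ ≡ᵇ 1 in eq
... | true  = mk⇔ (λ ()) (λ h → h (λ ()) (≡ᵇ⇒≡ ∣ nb ∣ 1 (subst T (sym eq) tt)))
... | false = mk⇔ (λ _ _ ∣nb∣≡1 → subst T eq (≡⇒≡ᵇ ∣ nb ∣ 1 ∣nb∣≡1)) (λ _ → tt)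

-- F at the neighbours of the vertex of role r in D_i, given F on D_i and F at c_{i-1} and a_{i+1}
neighbourValues : Bool → Subset 4 → Bool → Role → Subset 3
neighbourValues cBefore Dᵢ aAfter r =
  tabulate λ m → pick (link r (punchIn r m) (punchInᵢ≢i r m)) cBefore (lookup Dᵢ (punchIn r m)) aAfter

diamondFort : Bool → Subset 4 → Bool → Bool
diamondFort cBefore Dᵢ aAfter = ∀ᶠ λ r → fortConditionᵇ (lookup Dᵢ r) (neighbourValues cBefore Dᵢ aAfter r)

restrict : ∀ {k} → Subset (k * 4) → Fin k → Subset 4
restrict S i = tabulate (lookup S ∘ vertex i)

module _ {k : ℕ} where
  open Adjacency {k}

  ∈⇔T-restrict : ∀ {S : Subset (k * 4)} {i : Fin k} {r : Role} → vertex i r ∈ S ⇔ T (lookup (restrict S i) r)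
  ∈⇔T-restrict {S} {i} {r} = mk⇔ (subst T (sym lookup-restrict) ∘ to ∈⇔T) (from ∈⇔T ∘ subst T lookup-restrict)
    where lookup-restrict = lookup∘tabulate (lookup S ∘ vertex i) r

  module _ {p i q : Fin k} (p↝i : p ↝ i) (i↝q : i ↝ q) (F : Subset (k * 4)) where

    private
      values = neighbourValues (lookup F (vertex p C)) (restrict F i) (lookup F (vertex q A))

    values≡F∘neighbour : ∀ r → tabulate (lookup F ∘ neighbour p↝i i↝q r) ≡ values r
    values≡F∘neighbour r = tabulate-cong λ m → lookup-pick (link r (punchIn r m) (punchInᵢ≢i r m))
      where
      lookup-pick : ∀ {s} (l : Link r s) → lookup F (vertex (pick l p i q) s) ≡
                    pick l (lookup F (vertex p C)) (lookup (restrict F i) s) (lookup F (vertex q A))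
      lookup-pick {s} (inside _) = sym (lookup∘tabulate (lookup F ∘ vertex i) s)
      lookup-pick forward        = refl
      lookup-pick back           = refl

    diamondFort⇔ : T (diamondFort (lookup F (vertex p C)) (restrict F i) (lookup F (vertex q A))) ⇔
                   (∀ r → vertex i r ∉ F → ∣ F ∩ N G (vertex i r) ∣ ≢ 1)
    diamondFort⇔ = mk⇔
      (λ h r r∉F → to (condition⇔ r) (to (T-∀ᶠ condition) h r) (r∉F ∘ from ∈⇔T-restrict)
                   ∘ to (∣F∩N∣≡1⇔values r))
      (λ h → from (T-∀ᶠ condition) λ r → from (condition⇔ r) λ r∉F → h r (r∉F ∘ to ∈⇔T-restrict)
                   ∘ from (∣F∩N∣≡1⇔values r))
      where
      condition : Role → Bool
      condition r = fortConditionᵇ (lookup (restrict F i) r) (values r)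
      condition⇔ : ∀ r → T (condition r) ⇔ (¬ T (lookup (restrict F i) r) → ∣ values r ∣ ≢ 1)
      condition⇔ r = T-fortConditionᵇ {x = lookup (restrict F i) r} {nb = values r}

      ∣F∩N∣≡1⇔values : ∀ r → ∣ F ∩ N G (vertex i r) ∣ ≡ 1 ⇔ ∣ values r ∣ ≡ 1
      ∣F∩N∣≡1⇔values r = subst (λ nb → ∣ F ∩ N G (vertex i r) ∣ ≡ 1 ⇔ ∣ nb ∣ ≡ 1) (values≡F∘neighbour r)
                                 (∣F∩N∣≡1⇔∣F∘u∣≡1 G (neighbour-list p↝i i↝q r) F)

DiamondwiseFort : ∀ k → Subset (k * 4) → Set
DiamondwiseFort k F = ∀ {p i q : Fin k} → p ↝ i → i ↝ q →
                      T (diamondFort (lookup F (vertex p C)) (restrict F i) (lookup F (vertex q A)))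

IsFort⇒DiamondwiseFort : ∀ {k} {F : Subset (k * 4)} → IsFort (necklace k) F → DiamondwiseFort k F
IsFort⇒DiamondwiseFort {F = F} (_ , fort) {i = i} p↝i i↝q = from (diamondFort⇔ p↝i i↝q F) (λ r → fort (vertex i r))

DiamondwiseFort⇒IsFort : ∀ {n} {F : Subset (suc n * 4)} → Nonempty F → DiamondwiseFort (suc n) F → IsFort (necklace (suc n)) F
DiamondwiseFort⇒IsFort {n} {F} nonempty local = nonempty , λ v → at (combine-surjective {suc n} {4} v)
  where
  at : ∀ {v} → (∃ λ i → ∃ λ r → vertex i r ≡ v) → v ∉ F → ∣ F ∩ N (necklace (suc n)) v ∣ ≢ 1
  at (i , r , refl) = to (diamondFort⇔ p↝i i↝q F) (local p↝i i↝q) r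
    where
    p↝i = proj₂ (predecessor i)
    i↝q = proj₂ (successor i)

-- Two consecutive diamonds

data Side : Set where
  left right : Side

Position : Set
Position = Side × Role

_≟ˢ_ : DecidableEquality Side
left  ≟ˢ left  = yes refl
left  ≟ˢ right = no λ ()
right ≟ˢ left  = no λ ()
right ≟ˢ right = yes refl

_≟ᴾ_ : DecidableEquality Position
_≟ᴾ_ = ≡-dec _≟ˢ_ _≟_

∀ᴾ : (Position → Bool) → Bool
∀ᴾ P = ∀ᶠ (λ r → P (left , r)) ∧ ∀ᶠ (λ r → P (right , r))

∀ᴾ-intro : ∀ P → (∀ x → T (P x)) → T (∀ᴾ P)
∀ᴾ-intro P h = from (T-∧ {∀ᶠ λ r → P (left , r)}) (from (T-∀ᶠ _) (h ∘ (left ,_)) , from (T-∀ᶠ _) (h ∘ (right ,_)))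

pair : Subset 4 → Subset 4 → Side → Subset 4
pair L R left  = L
pair L R right = R

member : (Side → Subset 4) → Position → Bool
member Ds (s , r) = lookup (Ds s) r

-- a candidate fort on D_i ∪ D_{i+1}, together with its values at c_{i-1} and a_{i+2}
record Window : Set where
  constructor window
  field
    cBefore : Bool
    leftBlock rightBlock : Subset 4
    aAfter : Bool

  blocks : Side → Subset 4
  blocks = pair leftBlock rightBlock

open Window using (blocks)

windowFort : Window → Bool
windowFort (window c L R a) = diamondFort c L (lookup R A) ∧ diamondFort (lookup L C) R a

localPrivateFortᵇ : (Side → Subset 4) → Position → Window → Bool
localPrivateFortᵇ S x W =
  member (blocks W) x ∧ ∀ᴾ (λ y → not (member S y ∧ member (blocks W) y) ∨ ⌊ y ≟ᴾ x ⌋) ∧ windowFort W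

∀ᵂ : (Window → Bool) → Bool
∀ᵂ P = ∀ᵇ λ c → ∀ˢ λ L → ∀ˢ λ R → ∀ᵇ λ a → P (window c L R a)

∃ᵂ : (Window → Bool) → Bool
∃ᵂ P = not (∀ᵂ (not ∘ P))

∀ᵂ-sound : ∀ P → ∀ᵂ P ≡ true → ∀ W → P W ≡ true
∀ᵂ-sound P h (window c L R a) =
  ∀ᵇ-sound (P₃ c L R) (∀ˢ-sound (P₂ c L) (∀ˢ-sound (P₁ c) (∀ᵇ-sound P₀ h c) L) R) a
  where
  P₃ = λ c L R a → P (window c L R a)
  P₂ = λ c L R → ∀ᵇ (P₃ c L R)
  P₁ = λ c L → ∀ˢ (P₂ c L)
  P₀ = λ c → ∀ˢ (P₁ c)

∃ᵂ-intro : ∀ P W → T (P W) → T (∃ᵂ P)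
∃ᵂ-intro P W h with ∀ᵂ (not ∘ P) in all-fail
... | false = tt
... | true  = T-not (from T-≡ (∀ᵂ-sound (not ∘ P) all-fail W)) h

locallyZIrᵇ : Subset 4 → Subset 4 → Bool
locallyZIrᵇ L R = ∀ᴾ λ x → not (member (pair L R) x) ∨ ∃ᵂ (localPrivateFortᵇ (pair L R) x)

twoDiamondBoundᵇ : Subset 4 → Subset 4 → Bool
twoDiamondBoundᵇ L R = (∣ L ∣ + ∣ R ∣ ≤ᵇ 4) ∨ not (locallyZIrᵇ L R)

twoDiamondBoundᵇ-holds : ∀ˢ (λ L → ∀ˢ (twoDiamondBoundᵇ L)) ≡ true
twoDiamondBoundᵇ-holds = refl

two-diamond-bound : ∀ L R → T (locallyZIrᵇ L R) → ∣ L ∣ + ∣ R ∣ ≤ 4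
two-diamond-bound L R zir = bound-or-not-ZIr (to (T-∨ {∣ L ∣ + ∣ R ∣ ≤ᵇ 4} {not (locallyZIrᵇ L R)}) (from T-≡ checked))
  where
  checked : twoDiamondBoundᵇ L R ≡ true
  checked = ∀ˢ-sound (twoDiamondBoundᵇ L) (∀ˢ-sound (λ L → ∀ˢ (twoDiamondBoundᵇ L)) twoDiamondBoundᵇ-holds L) R
  bound-or-not-ZIr : T (∣ L ∣ + ∣ R ∣ ≤ᵇ 4) ⊎ T (not (locallyZIrᵇ L R)) → ∣ L ∣ + ∣ R ∣ ≤ 4
  bound-or-not-ZIr (inj₁ ≤4)   = ≤ᵇ⇒≤ (∣ L ∣ + ∣ R ∣) 4 ≤4
  bound-or-not-ZIr (inj₂ ¬zir) = ⊥-elim (T-not ¬zir zir)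

module _ {k : ℕ} {p i j l : Fin k} (i≢j : i ≢ j) (p↝i : p ↝ i) (i↝j : i ↝ j) (j↝l : j ↝ l) where

  diamondAt : Side → Fin k
  diamondAt left  = i
  diamondAt right = j

  vertexAt : Position → Fin (k * 4)
  vertexAt (s , r) = vertex (diamondAt s) r

  vertexAt-injective : ∀ {x y} → vertexAt x ≡ vertexAt y → x ≡ y
  vertexAt-injective {s , r} {s′ , r′} eq with combine-injective (diamondAt s) r (diamondAt s′) r′ eq
  ... | same-diamond , refl = cong (_, r) (diamondAt-injective s s′ same-diamond)
    where
    diamondAt-injective : ∀ s s′ → diamondAt s ≡ diamondAt s′ → s ≡ s′
    diamondAt-injective left  left  _   = refl
    diamondAt-injective left  right i≡j = ⊥-elim (i≢j i≡j)
    diamondAt-injective right left  j≡i = ⊥-elim (i≢j (sym j≡i))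
    diamondAt-injective right right _   = refl

  trace : Subset (k * 4) → Side → Subset 4
  trace S = pair (restrict S i) (restrict S j)

  member-trace⇔∈ : ∀ {S} x → T (member (trace S) x) ⇔ vertexAt x ∈ S
  member-trace⇔∈ {S} (left  , r) = ⇔-sym (∈⇔T-restrict {S = S} {i} {r})
  member-trace⇔∈ {S} (right , r) = ⇔-sym (∈⇔T-restrict {S = S} {j} {r})

  windowOf : Subset (k * 4) → Window
  windowOf F = window (lookup F (vertex p C)) (restrict F i) (restrict F j) (lookup F (vertex l A))

  windowFort-windowOf : ∀ {F} → IsFort (necklace k) F → T (windowFort (windowOf F))
  windowFort-windowOf fort = from T-∧ (diamondwise p↝i i↝j , diamondwise i↝j j↝l)
    where diamondwise = IsFort⇒DiamondwiseFort fort

  localPrivateFort-windowOf : ∀ {S F x} → IsPrivateFort (necklace k) S (vertexAt x) F →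
                              T (localPrivateFortᵇ (trace S) x (windowOf F))
  localPrivateFort-windowOf {S} {F} {x} (fort , _ , x∈F , only-x) =
    from T-∧ (from (member-trace⇔∈ x) x∈F , from T-∧ (∀ᴾ-intro private-at private-on-window , windowFort-windowOf fort))
    where
    private-at : Position → Bool
    private-at y = not (member (trace S) y ∧ member (trace F) y) ∨ ⌊ y ≟ᴾ x ⌋
    private-on-window : ∀ y → T (private-at y)
    private-on-window y = T-not-∨ λ y∈S∩F →
      let y∈S , y∈F = to (T-∧ {member (trace S) y}) y∈S∩F in
      fromWitness (vertexAt-injective (only-x (vertexAt y) (to (member-trace⇔∈ y) y∈S) (to (member-trace⇔∈ y) y∈F)))

  locallyZIr : ∀ {S} → IsZIrSet (necklace k) S → T (locallyZIrᵇ (restrict S i) (restrict S j))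
  locallyZIr {S} zir = ∀ᴾ-intro has-private-fort λ x → T-not-∨ λ x∈S →
    let F , private-fort = zir (vertexAt x) (to (member-trace⇔∈ x) x∈S) in
    ∃ᵂ-intro (localPrivateFortᵇ (trace S) x) (windowOf F) (localPrivateFort-windowOf private-fort)
    where
    has-private-fort : Position → Bool
    has-private-fort x = not (member (trace S) x) ∨ ∃ᵂ (localPrivateFortᵇ (trace S) x)

∣S∣≡sum-restrict : ∀ k (S : Subset (k * 4)) → ∣ S ∣ ≡ sum (λ (i : Fin k) → ∣ restrict S i ∣)
∣S∣≡sum-restrict zero    []                    = refl
∣S∣≡sum-restrict (suc k) (a ∷ b ∷ c ∷ d ∷ S) =
  trans (∣p++q∣≡∣p∣+∣q∣ (a ∷ b ∷ c ∷ d ∷ []) S) (cong (∣ a ∷ b ∷ c ∷ d ∷ [] ∣ +_) (∣S∣≡sum-restrict k S))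

∣ZIrSet∣≤2k : ∀ {n} → 2 ≤ suc n → ∀ {S : Subset (suc n * 4)} → IsZIrSet (necklace (suc n)) S →
              ∣ S ∣ ≤ 2 * suc n
∣ZIrSet∣≤2k {n} 2≤k {S} zir = *-cancelˡ-≤ {∣ S ∣} {2 * suc n} 2 (begin
  2 * ∣ S ∣                          ≡⟨ cong (2 *_) (∣S∣≡sum-restrict (suc n) S) ⟩
  2 * sum size                       ≤⟨ sum-cycle-≤ size pair-bound ⟩
  suc n * 4                          ≡⟨ solve 1 (λ k → k :* con 4 := con 2 :* (con 2 :* k)) refl (suc n) ⟩
  2 * (2 * suc n)                    ∎)
  where
  open ≤-Reasoning
  size : Fin (suc n) → ℕ
  size i = ∣ restrict S i ∣
  pair-bound : ∀ {i j} → i ↝ j → size i + size j ≤ 4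
  pair-bound {i} {j} i↝j =
    two-diamond-bound (restrict S i) (restrict S j) (locallyZIr i≢j (proj₂ (predecessor i)) i↝j (proj₂ (successor j)) zir)
    where
    i≢j : i ≢ j
    i≢j refl = ↝-irreflexive 2≤k i↝j

-- The ZIr-set {a_i, b_i}

ofPatterns : ∀ {k} → (Fin k → Subset 4) → Subset (k * 4)
ofPatterns P = concat (tabulate P)

lookup-ofPatterns : ∀ {k} (P : Fin k → Subset 4) i r → lookup (ofPatterns P) (vertex i r) ≡ lookup (P i) r
lookup-ofPatterns P i r = trans (lookup-concat (tabulate P) i r) (cong (λ D → lookup D r) (lookup∘tabulate P i))

restrict-ofPatterns : ∀ {k} (P : Fin k → Subset 4) i → restrict (ofPatterns P) i ≡ P i
restrict-ofPatterns P i = trans (tabulate-cong (lookup-ofPatterns P i)) (tabulate∘lookup (P i))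

DiamondwiseFort-ofPatterns : ∀ {k} (P : Fin k → Subset 4) →
  (∀ p i q → T (diamondFort (lookup (P p) C) (P i) (lookup (P q) A))) → DiamondwiseFort k (ofPatterns P)
DiamondwiseFort-ofPatterns P local {p} {i} {q} _ _ =
  subst₂ (λ c D → T (diamondFort c D (lookup (ofPatterns P) (vertex q A))))
         (sym (lookup-ofPatterns P p C)) (sym (restrict-ofPatterns P i))
         (subst (λ a → T (diamondFort (lookup (P p) C) (P i) a)) (sym (lookup-ofPatterns P q A)) (local p i q))

abPattern : Subset 4
abPattern = true ∷ true ∷ false ∷ false ∷ []

-- the traces on D_j of the private forts of a_i and b_i, where e tells whether j = i
aPattern bdPattern : Bool → Subset 4
aPattern  e = e ∷ false ∷ true ∷ not e ∷ []
bdPattern e = false ∷ e ∷ false ∷ e ∷ []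

aPattern-fort : ∀ e e′ → T (diamondFort true (aPattern e) e′)
aPattern-fort true  true  = tt
aPattern-fort true  false = tt
aPattern-fort false true  = tt
aPattern-fort false false = tt

bdPattern-fort : ∀ e → T (diamondFort false (bdPattern e) false)
bdPattern-fort true  = tt
bdPattern-fort false = tt

S₀ : ∀ k → Subset (k * 4)
S₀ k = ofPatterns {k} (λ _ → abPattern)

lookup-S₀ : ∀ {k} (i : Fin k) r → lookup (S₀ k) (vertex i r) ≡ lookup abPattern r
lookup-S₀ = lookup-ofPatterns (λ _ → abPattern)

∣S₀∣≡2k : ∀ k → ∣ S₀ k ∣ ≡ 2 * k
∣S₀∣≡2k zero    = refl
∣S₀∣≡2k (suc k) = trans (cong (2 +_) (∣S₀∣≡2k k)) (sym (*-suc 2 k))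

module _ {n : ℕ} where

  private-fort-ofPatterns : ∀ (P : Fin (suc n) → Subset 4) i r → T (lookup (P i) r) →
    (∀ j s → T (lookup abPattern s) → T (lookup (P j) s) → vertex j s ≡ vertex i r) →
    (∀ p j q → T (diamondFort (lookup (P p) C) (P j) (lookup (P q) A))) →
    vertex i r ∈ S₀ (suc n) → IsPrivateFort (necklace (suc n)) (S₀ (suc n)) (vertex i r) (ofPatterns P)
  private-fort-ofPatterns P i r x∈P only-x local x∈S₀ =
    DiamondwiseFort⇒IsFort (vertex i r , x∈F) (DiamondwiseFort-ofPatterns P local) , x∈S₀ , x∈F , only-x-in-F
    where
    x∈F : vertex i r ∈ ofPatterns P
    x∈F = from ∈⇔T (subst T (sym (lookup-ofPatterns P i r)) x∈P)
    only-x-in-F : ∀ y → y ∈ S₀ (suc n) → y ∈ ofPatterns P → y ≡ vertex i r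
    only-x-in-F y y∈S₀ y∈F with combine-surjective {suc n} {4} y
    ... | j , s , refl = only-x j s (subst T (lookup-S₀ j s) (to ∈⇔T y∈S₀))
                                    (subst T (lookup-ofPatterns P j s) (to ∈⇔T y∈F))

  S₀-ZIr : IsZIrSet (necklace (suc n)) (S₀ (suc n))
  S₀-ZIr x x∈S₀ with combine-surjective {suc n} {4} x
  ... | i , r , refl = by-role r (subst T (lookup-S₀ i r) (to ∈⇔T x∈S₀)) x∈S₀
    where
    by-role : ∀ r → T (lookup abPattern r) → vertex i r ∈ S₀ (suc n) →
              ∃ (IsPrivateFort (necklace (suc n)) (S₀ (suc n)) (vertex i r))
    by-role A _ x∈S₀ = _ , private-fort-ofPatterns (λ j → aPattern ⌊ j ≟ i ⌋) i A (fromWitness refl) only-aᵢ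
                             (λ _ j q → aPattern-fort ⌊ j ≟ i ⌋ ⌊ q ≟ i ⌋) x∈S₀
      where
      only-aᵢ : ∀ j s → T (lookup abPattern s) → T (lookup (aPattern ⌊ j ≟ i ⌋) s) → vertex j s ≡ vertex i A
      only-aᵢ j A _ j≡i = cong (λ j → vertex j A) (toWitness j≡i)
      only-aᵢ j B _ ()
      only-aᵢ j C () _
      only-aᵢ j D () _
    by-role B _ x∈S₀ = _ , private-fort-ofPatterns (λ j → bdPattern ⌊ j ≟ i ⌋) i B (fromWitness refl) only-bᵢ
                             (λ _ j _ → bdPattern-fort ⌊ j ≟ i ⌋) x∈S₀
      where
      only-bᵢ : ∀ j s → T (lookup abPattern s) → T (lookup (bdPattern ⌊ j ≟ i ⌋) s) → vertex j s ≡ vertex i B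
      only-bᵢ j A _ ()
      only-bᵢ j B _ j≡i = cong (λ j → vertex j B) (toWitness j≡i)
      only-bᵢ j C () _
      only-bᵢ j D () _
    by-role C ()
    by-role D ()

theorem4p4 : (k : ℕ) → 2 ≤ k → IsZIR (necklace k) (2 * k) × (2 * (2 * k) ≡ k * 4)
theorem4p4 (suc n) 2≤k =
  largest-ZIrSet⇒IsZIR (necklace (suc n)) S₀-ZIr (∣S₀∣≡2k (suc n)) (∣ZIrSet∣≤2k 2≤k) ,
  solve 1 (λ k → con 2 :* (con 2 :* k) := k :* con 4) refl (suc n)
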